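{- Let $r,k\in\mathbb{N}$. There are at most $2^{(r+\log r )k}$ distinct $r$-proper permutations $\pi\colon [k]\to[k]$.
   Context: $[k]=\{1,\dots,k\}$ and $\log$ is base $2$. A permutation $\pi\colon[k]\to[k]$ is $r$-proper if for every $j\in[k]$, $|\{\ell\le j : \pi(\ell)\ge j-1\}|\le r$. -}

module Defs where

open import Data.Nat using (ℕ; suc; _≤_; _≥_; _∸_; _≤?_; _^_; _*_)
open import Data.Fin using (Fin; toℕ)
open import Data.Fin.Permutation using (Permutation′; _⟨$⟩ʳ_)
open import Data.List using (List; length; filter)
open import Data.List.Base using () renaming (allFin to allFinL)
open import Data.Product using (Σ; _×_; _,_; proj₁)
open import Relation.Nullary.Decidable using (_×-dec_)
open import Relation.Binary.PropositionalEquality using (_≡_)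

-- [k] = {1,…,k} is represented by Fin k via i ↦ toℕ i + 1.
-- 1-based value of an element of Fin k:
val : ∀ {k} → Fin k → ℕ
val i = suc (toℕ i)

properCount : ∀ {k} → Permutation′ k → Fin k → ℕ
properCount {k} π j =
  length (filter (λ ℓ → (val ℓ ≤? val j) ×-dec ((val j ∸ 1) ≤? val (π ⟨$⟩ʳ ℓ)))
                 (allFinL k))

IsProper : ℕ → ∀ {k} → Permutation′ k → Set
IsProper r {k} π = (j : Fin k) → properCount π j ≤ r

ProperPerm : ℕ → ℕ → Set
ProperPerm r k = Σ (Permutation′ k) (IsProper r)

-- "There are at most N distinct elements": an injection into Fin N,
-- where two permutations are the same iff they agree pointwise.
AtMostProper : ℕ → ℕ → ℕ → Set
AtMostProper N r k =
  Σ (ProperPerm r k → Fin N) λ f →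
    ∀ (p q : ProperPerm r k) → f p ≡ f q →
      ∀ (i : Fin k) → proj₁ p ⟨$⟩ʳ i ≡ proj₁ q ⟨$⟩ʳ i

module Submission where

-- Work with 0-based positions and read π from left to right. At time t the positions l < t with
-- π l ≥ t and the values v < t with π⁻¹ v ≥ t are equally many, and properness bounds them by r.
-- Given the part of the graph of π inside [0, t)², its part inside [0, t]² is recovered from
-- whether π t = t, the rank of π⁻¹ t among those positions (r + 1 possibilities, one of them
-- meaning π⁻¹ t > t), and the rank of π t among those values; the latter has only r possibilities
-- because properCount at t also sees the preimage of t − 1. So a proper permutation is encoded by
-- k digits with at most 1 + (r + 1) r ≤ 2^r r values each, once r ≥ 2, which properness forces
-- as soon as k ≥ 2.

open import Defs
open import Data.Nat using (ℕ; zero; suc; _+_; _∸_; _*_; _^_; _≤_; _<_; z≤n; s≤s; s≤s⁻¹; _≟_; _≤?_; _<?_)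
open import Data.Nat.Properties
open import Algebra.Properties.CommutativeSemigroup +-commutativeSemigroup using (x∙yz≈y∙xz)
open import Algebra.Properties.CommutativeSemigroup *-commutativeSemigroup using (interchange)
open import Data.Fin using (Fin; toℕ; fromℕ<) renaming (zero to fzero; suc to fsuc)
open import Data.Fin.Properties using (toℕ<n; toℕ-fromℕ<; fromℕ<-toℕ; toℕ-injective; fromℕ<-injective)
open import Data.Fin.Permutation using (Permutation′; _⟨$⟩ʳ_; _⟨$⟩ˡ_)
import Data.Fin.Permutation as Permutation
open import Data.List using (_∷_; length; filter; tabulate)
open import Data.Product using (_×_; _,_; proj₁; proj₂)
open import Data.Sum using (inj₁; inj₂)
open import Function using (_∘_)
open import Relation.Nullary using (¬_; Dec; yes; no; contradiction)
open import Relation.Nullary.Decidable using (_×-dec_; ¬?)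
open import Relation.Unary using (Decidable)
open import Relation.Binary.PropositionalEquality
open import Relation.Binary.Definitions using (tri<; tri≈; tri>)

private variable
  a a′ b b′ c : ℕ
  j k l m n r t w : ℕ
  P Q : ℕ → Set

indicator : ∀ {ℓ} {A : Set ℓ} → Dec A → ℕ
indicator (yes _) = 1
indicator (no _)  = 0

indicator-cong : ∀ {ℓ ℓ′} {A : Set ℓ} {B : Set ℓ′} → (A → B) → (B → A) →
                 (a? : Dec A) (b? : Dec B) → indicator a? ≡ indicator b?
indicator-cong A→B B→A (yes a) (yes _) = refl
indicator-cong A→B B→A (yes a) (no ¬b) = contradiction (A→B a) ¬b
indicator-cong A→B B→A (no ¬a) (yes b) = contradiction (B→A b) ¬a
indicator-cong A→B B→A (no _)  (no _)  = refl

indicator-yes : ∀ {ℓ} {A : Set ℓ} (a? : Dec A) → A → indicator a? ≡ 1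
indicator-yes a? a = indicator-cong (λ _ → a) (λ _ → a) a? (yes a)

indicator-no : ∀ {ℓ} {A : Set ℓ} (a? : Dec A) → ¬ A → indicator a? ≡ 0
indicator-no a? ¬a = indicator-cong ¬a (λ ()) a? (no λ ())

countBelow : Decidable P → ℕ → ℕ
countBelow P? zero    = 0
countBelow P? (suc n) = indicator (P? n) + countBelow P? n

_∖_ : Decidable P → (w : ℕ) → Decidable (λ i → P i × i ≢ w)
(P? ∖ w) i = P? i ×-dec ¬? (i ≟ w)

countBelow-suc : (P? : Decidable P) (n : ℕ) →
                 countBelow P? (suc n) ≡ indicator (P? 0) + countBelow (P? ∘ suc) n
countBelow-suc P? zero    = refl
countBelow-suc P? (suc n) = begin
  indicator (P? (suc n)) + countBelow P? (suc n)
    ≡⟨ cong (indicator (P? (suc n)) +_) (countBelow-suc P? n) ⟩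
  indicator (P? (suc n)) + (indicator (P? 0) + countBelow (P? ∘ suc) n)
    ≡⟨ x∙yz≈y∙xz (indicator (P? (suc n))) (indicator (P? 0)) _ ⟩
  indicator (P? 0) + (indicator (P? (suc n)) + countBelow (P? ∘ suc) n)
    ∎
  where open ≡-Reasoning

countBelow-cong : (P? : Decidable P) (Q? : Decidable Q) →
                  (∀ {i} → i < n → P i → Q i) → (∀ {i} → i < n → Q i → P i) →
                  countBelow P? n ≡ countBelow Q? n
countBelow-cong {n = zero}  P? Q? P⇒Q Q⇒P = refl
countBelow-cong {n = suc n} P? Q? P⇒Q Q⇒P =
  cong₂ _+_ (indicator-cong (P⇒Q ≤-refl) (Q⇒P ≤-refl) (P? n) (Q? n))
            (countBelow-cong P? Q? (P⇒Q ∘ m<n⇒m<1+n) (Q⇒P ∘ m<n⇒m<1+n))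

countBelow-all : (P? : Decidable P) → (∀ {i} → i < n → P i) → countBelow P? n ≡ n
countBelow-all {n = zero}  P? all = refl
countBelow-all {n = suc n} P? all with P? n
... | yes _  = cong suc (countBelow-all P? (all ∘ m<n⇒m<1+n))
... | no ¬Pn = contradiction (all ≤-refl) ¬Pn

countBelow-complement : (P? : Decidable P) (n : ℕ) → countBelow P? n + countBelow (¬? ∘ P?) n ≡ n
countBelow-complement P? zero = refl
countBelow-complement P? (suc n) with P? n
... | yes _ = cong suc (countBelow-complement P? n)
... | no _  = trans (+-suc (countBelow P? n) _) (cong suc (countBelow-complement P? n))

countBelow-remove : (Q? : Decidable Q) → w < n → Q w →
                    countBelow Q? n ≡ suc (countBelow (Q? ∖ w) n)
countBelow-remove {w = w} {n = suc n} Q? w<1+n Qw with m<1+n⇒m<n∨m≡n w<1+n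
... | inj₁ w<n = begin
    indicator (Q? n) + countBelow Q? n
  ≡⟨ cong₂ _+_ (indicator-cong (λ Qn → Qn , λ n≡w → <-irrefl (sym n≡w) w<n) proj₁ (Q? n) _)
               (countBelow-remove Q? w<n Qw) ⟩
    indicator ((Q? ∖ w) n) + suc (countBelow (Q? ∖ w) n)
  ≡⟨ +-suc _ _ ⟩
    suc (countBelow (Q? ∖ w) (suc n))
  ∎ where open ≡-Reasoning
... | inj₂ refl = begin
    indicator (Q? w) + countBelow Q? w
  ≡⟨ cong₂ _+_ (indicator-yes (Q? w) Qw)
               (countBelow-cong Q? (Q? ∖ w)
                 (λ i<w Qi → Qi , λ i≡w → <-irrefl i≡w i<w) (λ _ → proj₁)) ⟩
    suc (countBelow (Q? ∖ w) w)
  ≡⟨ cong (suc ∘ (_+ countBelow (Q? ∖ w) w)) (indicator-no ((Q? ∖ w) w) λ (_ , w≢w) → w≢w refl) ⟨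
    suc (countBelow (Q? ∖ w) (suc w))
  ∎ where open ≡-Reasoning

countBelow-injection : (P? : Decidable P) (Q? : Decidable Q) (h : ℕ → ℕ) →
                       (∀ {i} → i < n → P i → h i < m × Q (h i)) →
                       (∀ {i j} → i < n → j < n → P i → P j → h i ≡ h j → i ≡ j) →
                       countBelow P? n ≤ countBelow Q? m
countBelow-injection {n = zero}  P? Q? h maps injective = z≤n
countBelow-injection {P = P} {Q = Q} {n = suc n} {m = m} P? Q? h maps injective with P? n
... | no _   = countBelow-injection P? Q? h (maps ∘ m<n⇒m<1+n)
                 (λ i<n j<n → injective (m<n⇒m<1+n i<n) (m<n⇒m<1+n j<n))
... | yes Pn = begin
    suc (countBelow P? n)
  ≤⟨ s≤s (countBelow-injection P? (Q? ∖ h n) h maps′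
            (λ i<n j<n → injective (m<n⇒m<1+n i<n) (m<n⇒m<1+n j<n))) ⟩
    suc (countBelow (Q? ∖ h n) m)
  ≡⟨ countBelow-remove Q? (proj₁ (maps ≤-refl Pn)) (proj₂ (maps ≤-refl Pn)) ⟨
    countBelow Q? m
  ∎
  where
  open ≤-Reasoning
  maps′ : ∀ {i} → i < n → P i → h i < m × (Q (h i) × h i ≢ h n)
  maps′ i<n Pi =
    let (hi<m , Qhi) = maps (m<n⇒m<1+n i<n) Pi
    in hi<m , Qhi , λ hi≡hn → <-irrefl (injective (m<n⇒m<1+n i<n) ≤-refl Pi Pn hi≡hn) i<n

countBelow-mono : (P? : Decidable P) (Q? : Decidable Q) → n ≤ m →
                  (∀ {i} → i < n → P i → Q i) → countBelow P? n ≤ countBelow Q? m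
countBelow-mono P? Q? n≤m P⇒Q =
  countBelow-injection P? Q? (λ i → i) (λ i<n Pi → <-≤-trans i<n n≤m , P⇒Q i<n Pi) (λ _ _ _ _ i≡j → i≡j)

countBelow-< : (P? : Decidable P) (Q? : Decidable Q) → n ≤ m →
               (∀ {i} → i < n → P i → Q i) → w < m → Q w → (w < n → ¬ P w) →
               countBelow P? n < countBelow Q? m
countBelow-< {n = n} {m = m} {w = w} P? Q? n≤m P⇒Q w<m Qw ¬Pw = begin-strict
    countBelow P? n
  <⟨ s≤s (countBelow-mono P? (Q? ∖ w) n≤m
           (λ i<n Pi → P⇒Q i<n Pi , λ { refl → ¬Pw i<n Pi })) ⟩
    suc (countBelow (Q? ∖ w) m)
  ≡⟨ countBelow-remove Q? w<m Qw ⟨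
    countBelow Q? m
  ∎ where open ≤-Reasoning

rank : Decidable P → ℕ → ℕ → ℕ
rank P? n a = countBelow (λ u → u <? a ×-dec P? u) n

rank-mono-< : (P? : Decidable P) → a < n → P a → a < b → rank P? n a < rank P? n b
rank-mono-< P? a<n Pa a<b =
  countBelow-< _ _ ≤-refl (λ _ (u<a , Pu) → <-trans u<a a<b , Pu) a<n (a<b , Pa) (λ _ (a<a , _) → <-irrefl refl a<a)

rank<count : (P? : Decidable P) → a < n → P a → rank P? n a < countBelow P? n
rank<count P? a<n Pa = countBelow-< _ P? ≤-refl (λ _ → proj₂) a<n Pa (λ _ (a<a , _) → <-irrefl refl a<a)

rank-injective : (P? : Decidable P) → a < n → b < n → P a → P b → rank P? n a ≡ rank P? n b → a ≡ b
rank-injective {a = a} {b = b} P? a<n b<n Pa Pb eq with <-cmp a b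
... | tri< a<b _ _ = contradiction eq (<⇒≢ (rank-mono-< P? a<n Pa a<b))
... | tri≈ _ a≡b _ = a≡b
... | tri> _ _ b<a = contradiction (sym eq) (<⇒≢ (rank-mono-< P? b<n Pb b<a))

rank-cong : (P? : Decidable P) (Q? : Decidable Q) →
            (∀ {i} → i < n → P i → Q i) → (∀ {i} → i < n → Q i → P i) →
            ∀ a → rank P? n a ≡ rank Q? n a
rank-cong P? Q? P⇒Q Q⇒P a =
  countBelow-cong (λ u → u <? a ×-dec P? u) (λ u → u <? a ×-dec Q? u)
    (λ u<n (u<a , Pu) → u<a , P⇒Q u<n Pu) (λ u<n (u<a , Qu) → u<a , Q⇒P u<n Qu)

rankCode : Decidable P → ℕ → ℕ → ℕ
rankCode P? n a with a <? n
... | yes _ = suc (rank P? n a)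
... | no _  = 0

rankCode-≤ : (P? : Decidable P) → (a < n → P a) → rankCode P? n a ≤ countBelow P? n
rankCode-≤ {a = a} {n = n} P? Pa with a <? n
... | yes a<n = rank<count P? a<n (Pa a<n)
... | no _    = z≤n

rankCode-injective : (P? : Decidable P) (Q? : Decidable Q) →
                     (∀ {i} → i < n → P i → Q i) → (∀ {i} → i < n → Q i → P i) →
                     a < n → P a → Q b → rankCode P? n a ≡ rankCode Q? n b → a ≡ b
rankCode-injective {n = n} {a = a} {b = b} P? Q? P⇒Q Q⇒P a<n Pa Qb eq with a <? n | b <? n
... | no a≮n | _       = contradiction a<n a≮n
... | yes _  | no _    = contradiction eq 1+n≢0
... | yes _  | yes b<n = rank-injective P? a<n b<n Pa (Q⇒P b<n Qb) (begin
    rank P? n a  ≡⟨ suc-injective eq ⟩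
    rank Q? n b  ≡⟨ rank-cong Q? P? Q⇒P P⇒Q b ⟩
    rank P? n b  ∎)
  where open ≡-Reasoning

remainder-quotient-< : a ≤ m → b < c → a + suc m * b < suc m * c
remainder-quotient-< {a} {m} {b} {c} a≤m b<c = begin-strict
  a + suc m * b      ≤⟨ +-monoˡ-≤ (suc m * b) a≤m ⟩
  m + suc m * b      <⟨ n<1+n _ ⟩
  suc m + suc m * b  ≡⟨ *-suc (suc m) b ⟨
  suc m * suc b      ≤⟨ *-monoʳ-≤ (suc m) b<c ⟩
  suc m * c          ∎
  where open ≤-Reasoning

remainder-quotient-unique : a ≤ m → a′ ≤ m → a + suc m * b ≡ a′ + suc m * b′ → a ≡ a′ × b ≡ b′
remainder-quotient-unique {a} {m} {a′} {b} {b′} a≤m a′≤m eq with <-cmp b b′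
... | tri< b<b′ _ _ = contradiction eq (<⇒≢ (<-≤-trans (remainder-quotient-< a≤m b<b′) (m≤n+m _ a′)))
... | tri≈ _ refl _ = +-cancelʳ-≡ _ a a′ eq , refl
... | tri> _ _ b′<b = contradiction (sym eq) (<⇒≢ (<-≤-trans (remainder-quotient-< a′≤m b′<b) (m≤n+m _ a)))

record IsPermBelow (k : ℕ) (f g : ℕ → ℕ) : Set where
  field
    f-< : l < k → f l < k
    inverseˡ : l < k → g (f l) ≡ l
    inverseʳ : l < k → f (g l) ≡ l

crosses? : (f : ℕ → ℕ) (t : ℕ) → Decidable (λ l → t ≤ f l)
crosses? f t l = t ≤? f l

crossing : (ℕ → ℕ) → ℕ → ℕ
crossing f t = countBelow (crosses? f t) t

-- properCount shifted to 0-based indices: with ℓ = l + 1, j = j′ + 1 and π ℓ = f l + 1,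
-- the condition π ℓ ≥ j − 1 becomes j′ ≤ f l + 1.
properCountℕ : ℕ → (ℕ → ℕ) → ℕ → ℕ
properCountℕ k f j = countBelow (λ l → l ≤? j ×-dec j ≤? suc (f l)) k

IsProperℕ : ℕ → ℕ → (ℕ → ℕ) → Set
IsProperℕ r k f = ∀ {j} → j < k → properCountℕ k f j ≤ r

crossing≤properCount : (f : ℕ → ℕ) → t < k → crossing f t ≤ properCountℕ k f t
crossing≤properCount f t<k =
  countBelow-mono _ _ (<⇒≤ t<k) (λ l<t t≤fl → <⇒≤ l<t , m≤n⇒m≤1+n t≤fl)

crossing<properCount : (f : ℕ → ℕ) → t < k → l ≤ t → suc (f l) ≡ t → crossing f t < properCountℕ k f t
crossing<properCount {t} {k} {l} f t<k l≤t fl+1≡t =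
  countBelow-< _ _ (<⇒≤ t<k) (λ l<t t≤fl → <⇒≤ l<t , m≤n⇒m≤1+n t≤fl)
    (≤-<-trans l≤t t<k) (l≤t , ≤-reflexive (sym fl+1≡t)) (λ _ t≤fl → <-irrefl refl (subst (_≤ f l) (sym fl+1≡t) t≤fl))

properCount-small : (f : ℕ → ℕ) → j ≤ 1 → j < k → suc j ≤ properCountℕ k f j
properCount-small {j} {k} f j≤1 j<k = begin
  suc j                                  ≡⟨ countBelow-all (_≤? j) s≤s⁻¹ ⟨
  countBelow (_≤? j) (suc j)             ≤⟨ countBelow-mono _ _ j<k (λ _ l≤j → l≤j , ≤-trans j≤1 (s≤s z≤n)) ⟩
  properCountℕ k f j                     ∎
  where open ≤-Reasoning

preimageCode imageCode : (f g : ℕ → ℕ) → ℕ → ℕ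
preimageCode f g t = rankCode (crosses? f t) t (g t)
imageCode    f g t = rankCode (crosses? g t) t (f t)

stepCode : ℕ → (f g : ℕ → ℕ) → ℕ → ℕ
stepCode r f g t with f t ≟ t
... | yes _ = 0
... | no _  = suc (preimageCode f g t + suc r * imageCode f g t)

module _ {k : ℕ} {f g : ℕ → ℕ} (perm : IsPermBelow k f g) where
  open IsPermBelow perm

  f-injective : a < k → b < k → f a ≡ f b → a ≡ b
  f-injective a<k b<k fa≡fb = trans (sym (inverseˡ a<k)) (trans (cong g fa≡fb) (inverseˡ b<k))

  image-crosses : t < k → t ≤ g (f t)
  image-crosses t<k = ≤-reflexive (sym (inverseˡ t<k))

  preimage-crosses : t < k → t ≤ f (g t)
  preimage-crosses t<k = ≤-reflexive (sym (inverseʳ t<k))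

  crossing-balance : t ≤ k → crossing g t ≤ crossing f t
  crossing-balance {t} t≤k = +-cancelʳ-≤ (stays g) _ _ (begin
    crossing g t + stays g  ≡⟨ countBelow-complement (crosses? g t) t ⟩
    t                       ≡⟨ countBelow-complement (crosses? f t) t ⟨
    crossing f t + stays f  ≤⟨ +-monoʳ-≤ (crossing f t) stays-f≤stays-g ⟩
    crossing f t + stays g  ∎)
    where
    open ≤-Reasoning
    stays : (ℕ → ℕ) → ℕ
    stays h = countBelow (¬? ∘ crosses? h t) t
    stays-f≤stays-g : stays f ≤ stays g
    stays-f≤stays-g = countBelow-injection _ _ f
      (λ l<t t≰fl → ≰⇒> t≰fl , λ t≤gfl → <⇒≱ l<t (subst (t ≤_) (inverseˡ (<-≤-trans l<t t≤k)) t≤gfl))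
      (λ i<t j<t _ _ → f-injective (<-≤-trans i<t t≤k) (<-≤-trans j<t t≤k))

  module _ {r : ℕ} (proper : IsProperℕ r k f) where

    crossing≤r : t < k → crossing f t ≤ r
    crossing≤r t<k = ≤-trans (crossing≤properCount f t<k) (proper t<k)

    preimageCode≤r : t < k → preimageCode f g t ≤ r
    preimageCode≤r t<k =
      ≤-trans (rankCode-≤ (crosses? f _) (λ _ → preimage-crosses t<k)) (crossing≤r t<k)

    -- Either the position g (t − 1) is at most t, and then properCount counts it although it does
    -- not cross t, or the value t − 1 crosses t and lies strictly above f t.
    image-rank+2≤r : t < k → f t < t → 2 + rank (crosses? g t) t (f t) ≤ r
    image-rank+2≤r {t@(suc s)} t<k ft<t with g s ≤? suc s
    ... | yes gs≤t = begin
      2 + rank (crosses? g t) t (f t)  ≤⟨ s≤s (rank<count (crosses? g t) ft<t (image-crosses t<k)) ⟩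
      suc (crossing g t)               ≤⟨ s≤s (crossing-balance (<⇒≤ t<k)) ⟩
      suc (crossing f t)               ≤⟨ crossing<properCount f t<k gs≤t (cong suc (inverseʳ s<k)) ⟩
      properCountℕ k f t               ≤⟨ proper t<k ⟩
      r                                ∎
      where
      open ≤-Reasoning
      s<k : s < k
      s<k = <-trans (n<1+n s) t<k
    ... | no gs≰t = begin
      2 + rank (crosses? g t) t (f t)  ≤⟨ s≤s (rank-mono-< (crosses? g t) ft<t (image-crosses t<k) ft<s) ⟩
      suc (rank (crosses? g t) t s)    ≤⟨ rank<count (crosses? g t) (n<1+n s) (<⇒≤ (≰⇒> gs≰t)) ⟩
      crossing g t                     ≤⟨ crossing-balance (<⇒≤ t<k) ⟩
      crossing f t                     ≤⟨ crossing≤r t<k ⟩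
      r                                ∎
      where
      open ≤-Reasoning
      ft<s : f t < s
      ft<s = ≤∧≢⇒< (s≤s⁻¹ ft<t) λ ft≡s → gs≰t (subst (λ v → g v ≤ t) ft≡s (≤-reflexive (inverseˡ t<k)))

    imageCode<r : 1 ≤ r → t < k → imageCode f g t < r
    imageCode<r {t} 1≤r t<k with f t <? t
    ... | yes ft<t = image-rank+2≤r t<k ft<t
    ... | no _     = 1≤r

    stepCode≤ : 1 ≤ r → t < k → stepCode r f g t ≤ suc r * r
    stepCode≤ {t} 1≤r t<k with f t ≟ t
    ... | yes _ = z≤n
    ... | no _  = remainder-quotient-< (preimageCode≤r t<k) (imageCode<r 1≤r t<k)

_⊆[_]_ : (ℕ → ℕ) → ℕ → (ℕ → ℕ) → Set
f ⊆[ t ] f′ = ∀ {l v} → l < t → v < t → f l ≡ v → f′ l ≡ v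

crossing-transfer : {f f′ : ℕ → ℕ} → f′ ⊆[ t ] f → l < t → t ≤ f l → t ≤ f′ l
crossing-transfer f′⊆f l<t t≤fl = ≮⇒≥ λ f′l<t → <⇒≱ f′l<t (subst (_ ≤_) (f′⊆f l<t f′l<t refl) t≤fl)

inverse-crossing-transfer : {f g f′ g′ : ℕ → ℕ} → IsPermBelow k f g → IsPermBelow k f′ g′ → t ≤ k →
                            f′ ⊆[ t ] f → l < t → t ≤ g l → t ≤ g′ l
inverse-crossing-transfer {k = k} {t = t} {l = l} {f = f} {g} {f′} {g′} perm perm′ t≤k f′⊆f l<t t≤gl =
  ≮⇒≥ λ g′l<t → <⇒≱ g′l<t (subst (t ≤_) (gl≡g′l g′l<t) t≤gl)
  where
  open IsPermBelow
  gl≡g′l : g′ l < t → g l ≡ g′ l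
  gl≡g′l g′l<t = begin
    g l           ≡⟨ cong g (f′⊆f g′l<t l<t (inverseʳ perm′ (<-≤-trans l<t t≤k))) ⟨
    g (f (g′ l))  ≡⟨ inverseˡ perm (<-≤-trans g′l<t t≤k) ⟩
    g′ l          ∎
    where open ≡-Reasoning

module Decoding {r k : ℕ} {f g f′ g′ : ℕ → ℕ} (perm : IsPermBelow k f g) (perm′ : IsPermBelow k f′ g′)
                (proper : IsProperℕ r k f) (proper′ : IsProperℕ r k f′) where

  fixed-transfer : stepCode r f g t ≡ stepCode r f′ g′ t → f t ≡ t → f′ t ≡ t
  fixed-transfer {t} same ft≡t with f t ≟ t | f′ t ≟ t
  ... | _       | yes f′t≡t = f′t≡t
  ... | yes _   | no _      = contradiction same 0≢1+n
  ... | no ft≢t | no _      = contradiction ft≡t ft≢t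

  moved-codes : t < k → f t ≢ t → stepCode r f g t ≡ stepCode r f′ g′ t →
                preimageCode f g t ≡ preimageCode f′ g′ t × imageCode f g t ≡ imageCode f′ g′ t
  moved-codes {t} t<k ft≢t same with f t ≟ t | f′ t ≟ t
  ... | yes ft≡t | _    = contradiction ft≡t ft≢t
  ... | no _     | yes _ = contradiction same 1+n≢0
  ... | no _     | no _  =
    remainder-quotient-unique (preimageCode≤r perm proper t<k) (preimageCode≤r perm′ proper′ t<k) (suc-injective same)

  module _ (t<k : t < k) (f⊆f′ : f ⊆[ t ] f′) (f′⊆f : f′ ⊆[ t ] f)
           (same : stepCode r f g t ≡ stepCode r f′ g′ t) where

    image-transfer : f t < t → f′ t ≡ f t
    image-transfer ft<t = sym (rankCode-injective (crosses? g t) (crosses? g′ t)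
      (inverse-crossing-transfer perm perm′ (<⇒≤ t<k) f′⊆f) (inverse-crossing-transfer perm′ perm (<⇒≤ t<k) f⊆f′)
      ft<t (image-crosses perm t<k) (image-crosses perm′ t<k)
      (proj₂ (moved-codes t<k (<⇒≢ ft<t) same)))

    preimage-transfer : l < t → f l ≡ t → f′ l ≡ t
    preimage-transfer {l} l<t fl≡t = begin
      f′ l      ≡⟨ cong f′ (trans (sym gt≡l) gt≡g′t) ⟩
      f′ (g′ t) ≡⟨ IsPermBelow.inverseʳ perm′ t<k ⟩
      t         ∎
      where
      open ≡-Reasoning
      gt≡l : g t ≡ l
      gt≡l = trans (cong g (sym fl≡t)) (IsPermBelow.inverseˡ perm (<-trans l<t t<k))
      gt<t : g t < t
      gt<t = subst (_< t) (sym gt≡l) l<t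
      ft≢t : f t ≢ t
      ft≢t ft≡t = <⇒≢ gt<t (trans (cong g (sym ft≡t)) (IsPermBelow.inverseˡ perm t<k))
      gt≡g′t : g t ≡ g′ t
      gt≡g′t = rankCode-injective (crosses? f t) (crosses? f′ t)
        (crossing-transfer f′⊆f) (crossing-transfer f⊆f′)
        gt<t (preimage-crosses perm t<k) (preimage-crosses perm′ t<k)
        (proj₁ (moved-codes t<k ft≢t same))

    ⊆-step : f ⊆[ suc t ] f′
    ⊆-step l<t+1 v<t+1 fl≡v with m<1+n⇒m<n∨m≡n l<t+1 | m<1+n⇒m<n∨m≡n v<t+1
    ... | inj₁ l<t  | inj₁ v<t  = f⊆f′ l<t v<t fl≡v
    ... | inj₂ refl | inj₂ refl = fixed-transfer same fl≡v
    ... | inj₂ refl | inj₁ v<t  = trans (image-transfer (subst (_< t) (sym fl≡v) v<t)) fl≡v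
    ... | inj₁ l<t  | inj₂ refl = preimage-transfer l<t fl≡v

stepCode-injective : {r k : ℕ} {f g f′ g′ : ℕ → ℕ} → IsPermBelow k f g → IsPermBelow k f′ g′ →
                     IsProperℕ r k f → IsProperℕ r k f′ →
                     (∀ {t} → t < k → stepCode r f g t ≡ stepCode r f′ g′ t) → l < k → f l ≡ f′ l
stepCode-injective {k = k} {f = f} {f′ = f′} perm perm′ proper proper′ same l<k =
  sym (proj₁ (agree ≤-refl) l<k (IsPermBelow.f-< perm l<k) refl)
  where
  agree : t ≤ k → f ⊆[ t ] f′ × f′ ⊆[ t ] f
  agree {zero}  _   = (λ ()) , (λ ())
  agree {suc t} t<k =
    let (f⊆f′ , f′⊆f) = agree (<⇒≤ t<k)
    in Decoding.⊆-step perm perm′ proper proper′ t<k f⊆f′ f′⊆f (same t<k)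
     , Decoding.⊆-step perm′ perm proper′ proper t<k f′⊆f f⊆f′ (sym (same t<k))

fromDigits : ℕ → (ℕ → ℕ) → ℕ → ℕ
fromDigits base d zero    = 0
fromDigits base d (suc n) = d n + base * fromDigits base d n

fromDigits-< : (d : ℕ → ℕ) → (∀ {i} → i < n → d i ≤ m) → fromDigits (suc m) d n < suc m ^ n
fromDigits-< {zero}  d d≤m = s≤s z≤n
fromDigits-< {suc n} d d≤m = remainder-quotient-< (d≤m ≤-refl) (fromDigits-< d (d≤m ∘ m<n⇒m<1+n))

fromDigits-injective : (d d′ : ℕ → ℕ) → (∀ {i} → i < n → d i ≤ m) → (∀ {i} → i < n → d′ i ≤ m) →
                       fromDigits (suc m) d n ≡ fromDigits (suc m) d′ n → l < n → d l ≡ d′ l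
fromDigits-injective {suc n} d d′ d≤m d′≤m same l<n+1
  with remainder-quotient-unique (d≤m ≤-refl) (d′≤m ≤-refl) same | m<1+n⇒m<n∨m≡n l<n+1
... | dn≡d′n , _ | inj₂ refl = dn≡d′n
... | _ , rest   | inj₁ l<n  = fromDigits-injective d d′ (d≤m ∘ m<n⇒m<1+n) (d′≤m ∘ m<n⇒m<1+n) rest l<n

extendℕ : (Fin k → Fin k) → ℕ → ℕ
extendℕ {k} h l with l <? k
... | yes l<k = toℕ (h (fromℕ< l<k))
... | no _    = 0

extendℕ-toℕ : (h : Fin k → Fin k) (i : Fin k) → extendℕ h (toℕ i) ≡ toℕ (h i)
extendℕ-toℕ {k} h i with toℕ i <? k
... | yes i<k = cong (toℕ ∘ h) (fromℕ<-toℕ i i<k)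
... | no i≮k  = contradiction (toℕ<n i) i≮k

extendℕ-< : (h : Fin k → Fin k) → l < k → extendℕ h l < k
extendℕ-< {k} {l} h l<k with l <? k
... | yes _   = toℕ<n _
... | no l≮k  = contradiction l<k l≮k

∀-toℕ⇒∀< : (Q : ℕ → Set) → (∀ (i : Fin k) → Q (toℕ i)) → l < k → Q l
∀-toℕ⇒∀< Q Q-toℕ l<k = subst Q (toℕ-fromℕ< l<k) (Q-toℕ (fromℕ< l<k))

forwardℕ backwardℕ : Permutation′ k → ℕ → ℕ
forwardℕ  π = extendℕ (π ⟨$⟩ʳ_)
backwardℕ π = extendℕ (π ⟨$⟩ˡ_)

isPermBelow : (π : Permutation′ k) → IsPermBelow k (forwardℕ π) (backwardℕ π)
isPermBelow π = record
  { f-<      = extendℕ-< (π ⟨$⟩ʳ_)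
  ; inverseˡ = ∀-toℕ⇒∀< (λ l → backwardℕ π (forwardℕ π l) ≡ l) λ i → begin
      backwardℕ π (forwardℕ π (toℕ i))  ≡⟨ cong (backwardℕ π) (extendℕ-toℕ (π ⟨$⟩ʳ_) i) ⟩
      backwardℕ π (toℕ (π ⟨$⟩ʳ i))      ≡⟨ extendℕ-toℕ (π ⟨$⟩ˡ_) (π ⟨$⟩ʳ i) ⟩
      toℕ (π ⟨$⟩ˡ (π ⟨$⟩ʳ i))           ≡⟨ cong toℕ (Permutation.inverseˡ π) ⟩
      toℕ i                             ∎
  ; inverseʳ = ∀-toℕ⇒∀< (λ l → forwardℕ π (backwardℕ π l) ≡ l) λ i → begin
      forwardℕ π (backwardℕ π (toℕ i))  ≡⟨ cong (forwardℕ π) (extendℕ-toℕ (π ⟨$⟩ˡ_) i) ⟩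
      forwardℕ π (toℕ (π ⟨$⟩ˡ i))       ≡⟨ extendℕ-toℕ (π ⟨$⟩ʳ_) (π ⟨$⟩ˡ i) ⟩
      toℕ (π ⟨$⟩ʳ (π ⟨$⟩ˡ i))           ≡⟨ cong toℕ (Permutation.inverseʳ π) ⟩
      toℕ i                             ∎
  }
  where open ≡-Reasoning

length-filter-tabulate : ∀ {a p} {A : Set a} {X : A → Set p} (X? : Decidable X) (h : Fin n → A) →
                         (Q? : Decidable Q) →
                         (∀ i → X (h i) → Q (toℕ i)) → (∀ i → Q (toℕ i) → X (h i)) →
                         length (filter X? (tabulate h)) ≡ countBelow Q? n
length-filter-tabulate {zero}  X? h Q? X⇒Q Q⇒X = refl
length-filter-tabulate {suc n} X? h Q? X⇒Q Q⇒X = begin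
  length (filter X? (tabulate h))
    ≡⟨ length-filter-∷ (h fzero) (tabulate (h ∘ fsuc)) ⟩
  indicator (X? (h fzero)) + length (filter X? (tabulate (h ∘ fsuc)))
    ≡⟨ cong₂ _+_ (indicator-cong (X⇒Q fzero) (Q⇒X fzero) (X? (h fzero)) (Q? 0))
                 (length-filter-tabulate X? (h ∘ fsuc) (Q? ∘ suc) (X⇒Q ∘ fsuc) (Q⇒X ∘ fsuc)) ⟩
  indicator (Q? 0) + countBelow (Q? ∘ suc) n
    ≡⟨ countBelow-suc Q? n ⟨
  countBelow Q? (suc n)
    ∎
  where
  open ≡-Reasoning
  length-filter-∷ : ∀ x xs → length (filter X? (x ∷ xs)) ≡ indicator (X? x) + length (filter X? xs)
  length-filter-∷ x xs with X? x
  ... | yes _ = refl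
  ... | no _  = refl

properCount≡properCountℕ : (π : Permutation′ k) (j : Fin k) →
                           properCount π j ≡ properCountℕ k (forwardℕ π) (toℕ j)
properCount≡properCountℕ {k} π j =
  length-filter-tabulate (λ ℓ → (val ℓ ≤? val j) ×-dec ((val j ∸ 1) ≤? val (π ⟨$⟩ʳ ℓ))) (λ i → i)
    (λ l → l ≤? toℕ j ×-dec toℕ j ≤? suc (forwardℕ π l))
  (λ i (i≤j , j≤πi) → s≤s⁻¹ i≤j , subst (λ v → toℕ j ≤ suc v) (sym (extendℕ-toℕ (π ⟨$⟩ʳ_) i)) j≤πi)
  (λ i (i≤j , j≤πi) → s≤s i≤j , subst (λ v → toℕ j ≤ suc v) (extendℕ-toℕ (π ⟨$⟩ʳ_) i) j≤πi)

isProperℕ : (π : Permutation′ k) → IsProper r π → IsProperℕ r k (forwardℕ π)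
isProperℕ {k} {r} π proper =
  ∀-toℕ⇒∀< {k = k} (λ j → properCountℕ k (forwardℕ π) j ≤ r)
    (λ j → subst (_≤ r) (properCount≡properCountℕ π j) (proper j))

properness-lower-bound : {f : ℕ → ℕ} → IsProperℕ r k f → j ≤ 1 → j < k → j < r
properness-lower-bound {f = f} proper j≤1 j<k = ≤-trans (properCount-small f j≤1 j<k) (proper j<k)

2+n≤2^n : 2 ≤ n → 2 + n ≤ 2 ^ n
2+n≤2^n {suc zero}            (s≤s ())
2+n≤2^n {suc (suc zero)}      _ = ≤-refl
2+n≤2^n {suc m@(suc (suc _))} _ = begin
  1 + (2 + m)        ≤⟨ +-monoˡ-≤ (2 + m) {1} {2 + m} (s≤s z≤n) ⟩
  (2 + m) + (2 + m)  ≤⟨ +-mono-≤ (2+n≤2^n (s≤s (s≤s z≤n))) (2+n≤2^n (s≤s (s≤s z≤n))) ⟩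
  2 ^ m + 2 ^ m      ≡⟨ cong (2 ^ m +_) (+-identityʳ (2 ^ m)) ⟨
  2 ^ suc m          ∎
  where open ≤-Reasoning

codeBase≤2^r*r : 2 ≤ r → suc (suc r * r) ≤ 2 ^ r * r
codeBase≤2^r*r {r} 2≤r =
  ≤-trans (+-monoˡ-≤ (suc r * r) (≤-trans (s≤s z≤n) 2≤r)) (*-monoˡ-≤ r (2+n≤2^n 2≤r))

^-distribʳ-* : ∀ a b n → (a * b) ^ n ≡ a ^ n * b ^ n
^-distribʳ-* a b zero    = refl
^-distribʳ-* a b (suc n) = trans (cong (a * b *_) (^-distribʳ-* a b n))
  (interchange a b (a ^ n) (b ^ n))

bound-positive : 0 < r → ∀ k → 0 < 2 ^ (r * k) * r ^ k
bound-positive {suc r} _ k = *-mono-≤ (m^n>0 2 (suc r * k)) (m^n>0 (suc r) k)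

stepCodes : ℕ → Permutation′ k → ℕ → ℕ
stepCodes r π = stepCode r (forwardℕ π) (backwardℕ π)

stepCodes≤ : 1 ≤ r → ((π , _) : ProperPerm r k) → t < k → stepCodes r π t ≤ suc r * r
stepCodes≤ 1≤r (π , proper) = stepCode≤ (isPermBelow π) (isProperℕ π proper) 1≤r

encode : (r : ℕ) → ProperPerm r k → ℕ
encode {k} r (π , _) = fromDigits (suc (suc r * r)) (stepCodes r π) k

encode-< : 2 ≤ r → (p : ProperPerm r k) → encode r p < 2 ^ (r * k) * r ^ k
encode-< {r} {k} 2≤r p = begin-strict
  encode r p             <⟨ fromDigits-< _ (stepCodes≤ (≤-trans (s≤s z≤n) 2≤r) p) ⟩
  suc (suc r * r) ^ k    ≤⟨ ^-monoˡ-≤ k (codeBase≤2^r*r 2≤r) ⟩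
  (2 ^ r * r) ^ k        ≡⟨ ^-distribʳ-* (2 ^ r) r k ⟩
  (2 ^ r) ^ k * r ^ k    ≡⟨ cong (_* r ^ k) (^-*-assoc 2 r k) ⟩
  2 ^ (r * k) * r ^ k    ∎
  where open ≤-Reasoning

encode-injective : 1 ≤ r → (p q : ProperPerm r k) → encode r p ≡ encode r q →
                   ∀ i → proj₁ p ⟨$⟩ʳ i ≡ proj₁ q ⟨$⟩ʳ i
encode-injective 1≤r p@(π , properπ) q@(σ , properσ) same i = toℕ-injective (begin
  toℕ (π ⟨$⟩ʳ i)      ≡⟨ extendℕ-toℕ (π ⟨$⟩ʳ_) i ⟨
  forwardℕ π (toℕ i)  ≡⟨ stepCode-injective (isPermBelow π) (isPermBelow σ)
                           (isProperℕ π properπ) (isProperℕ σ properσ)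
                           (fromDigits-injective _ _ (stepCodes≤ 1≤r p) (stepCodes≤ 1≤r q) same)
                           (toℕ<n i) ⟩
  forwardℕ σ (toℕ i)  ≡⟨ extendℕ-toℕ (σ ⟨$⟩ʳ_) i ⟩
  toℕ (σ ⟨$⟩ʳ i)      ∎)
  where open ≡-Reasoning

atMostProper : {N : ℕ} (code : ProperPerm r k → ℕ) → (∀ p → code p < N) →
               (∀ p q → code p ≡ code q → ∀ i → proj₁ p ⟨$⟩ʳ i ≡ proj₁ q ⟨$⟩ʳ i) → AtMostProper N r k
atMostProper code code<N code-injective =
  (λ p → fromℕ< (code<N p)) , λ p q same → code-injective p q (fromℕ<-injective _ _ (code<N p) (code<N q) same)

lemma9 : (r k : ℕ) → AtMostProper ((2 ^ (r * k)) * (r ^ k)) r k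
lemma9 r zero = atMostProper (λ _ → 0) (λ _ → *-monoˡ-≤ 1 (m^n>0 2 (r * 0))) (λ _ _ _ ())
lemma9 r (suc zero) = atMostProper (λ _ → 0) (λ (π , proper) → bound-positive (r>0 π proper) 1) λ _ _ _ _ → Fin1-unique
  where
  r>0 : (π : Permutation′ 1) → IsProper r π → 0 < r
  r>0 π proper = properness-lower-bound {f = forwardℕ π} (isProperℕ π proper) z≤n (s≤s z≤n)
  Fin1-unique : {i j : Fin 1} → i ≡ j
  Fin1-unique {fzero} {fzero} = refl
lemma9 r k@(suc (suc _)) = atMostProper (encode r) (λ p → encode-< (r≥2 p) p)
  (λ p q → encode-injective (≤-trans (s≤s z≤n) (r≥2 p)) p q)
  where
  r≥2 : ProperPerm r k → 2 ≤ r
  r≥2 (π , proper) = properness-lower-bound {f = forwardℕ π} (isProperℕ π proper) (s≤s z≤n) (s≤s (s≤s z≤n))
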